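{- Let $n\ge3$ be odd, $p$ a prime, and $B=p^kB'$, $C=p^\ell C'$ nonzero integers with $p\nmid B'C'$. Suppose $1<k<n+1$ and $\ell=1$. Let $(x,y,z)\in\mathbb{Z}_p^3$ be a primitive triple (not all of $x,y,z$ divisible by $p$). Then $[x:y:z]\in\mathcal{Y}_{B,C}(\mathbb{Z}_p)$, i.e. $x^2+By^2=Cz^n$, if and only if one of the following holds: (i) $k$ is even, $p^{k/2}\mid x$, $p\mid z$, and $(X,Y,Z)=(x/p^{k/2},y,z/p)$ satisfies $X^2+B'Y^2=p^{n+1-k}C'Z^n$; (ii) $k$ is odd, $p^{(k+1)/2}\mid x$, $p\mid z$, and $(X,Y,Z)=(x/p^{(k+1)/2},y,z/p)$ satisfies $pX^2+B'Y^2=p^{n+1-k}C'Z^n$.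
   Context: $\mathcal{Y}_{B,C}(\mathbb{Z}_p)$ denotes the groupoid whose objects are primitive triples $(x,y,z)\in\mathbb{Z}_p^3$ with $x^2+By^2=Cz^n$, written $[x:y:z]$, with morphisms given by units $\lambda$ acting as $(x,y,z)\mapsto(\lambda^nx,\lambda^ny,\lambda^2z)$ (the $\mathbb{Z}_p$-points of the quotient stack $[S/\mathbb{G}_m]$ with $S:x^2+By^2=Cz^n$ minus the origin). -}

module Defs where

-- The ring ℤ_p of p-adic integers, modelled constructively as coherent
-- sequences of integers (x₀, x₁, x₂, …) with p^m ∣ x_{m+1} − x_m,
-- with setoid equality x ≈ y  iff  p^m ∣ x_m − y_m for every m.

open import Data.Nat as ℕ using (ℕ; zero; suc)
open import Data.Integer as ℤ using (ℤ; +_; _+_; _-_; _*_)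
open import Data.Integer.Divisibility.Signed using (_∣_; ∣m∣n⇒∣m+n; ∣n⇒∣m*n; ∣m⇒∣m*n)
open import Data.Integer.Solver using (module +-*-Solver)
open import Data.Product using (Σ; _×_; _,_)
open import Relation.Binary.PropositionalEquality using (_≡_; subst)
open import Relation.Nullary using (¬_)

open +-*-Solver

record ℤp (p : ℕ) : Set where
  constructor mkℤp
  field
    seq : ℕ → ℤ
    coh : ∀ m → (+ (p ℕ.^ m)) ∣ (seq (suc m) - seq m)
open ℤp public

module _ {p : ℕ} where

  infix 4 _≈_ _∣ₚ_
  infixl 6 _+ₚ_
  infixl 7 _*ₚ_
  infixr 8 _^ₚ_

  _≈_ : ℤp p → ℤp p → Set
  x ≈ y = ∀ m → (+ (p ℕ.^ m)) ∣ (seq x m - seq y m)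

  ι : ℤ → ℤp p
  ι a = mkℤp (λ _ → a) (λ m → subst (λ t → (+ (p ℕ.^ m)) ∣ t) (lem a) (∣n⇒∣m*n 0ℤ' (∣-zero m)))
    where
    0ℤ' : ℤ
    0ℤ' = + 0
    lem : ∀ a → 0ℤ' * (a - a) ≡ a - a
    lem = solve 1 (λ a → con (+ 0) :* (a :- a) := a :- a) Relation.Binary.PropositionalEquality.refl
      where import Relation.Binary.PropositionalEquality
    ∣-zero : ∀ m → (+ (p ℕ.^ m)) ∣ (a - a)
    ∣-zero m = subst (λ t → (+ (p ℕ.^ m)) ∣ t) (lem2 a) (∣n⇒∣m*n (+ 0) Data.Integer.Divisibility.Signed.∣-refl)
      where
      import Data.Integer.Divisibility.Signed
      lem2 : ∀ a → (+ 0) * (+ (p ℕ.^ m)) ≡ a - a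
      lem2 = solve 1 (λ a → con (+ 0) :* con (+ (p ℕ.^ m)) := a :- a) Relation.Binary.PropositionalEquality.refl
        where import Relation.Binary.PropositionalEquality

  _+ₚ_ : ℤp p → ℤp p → ℤp p
  x +ₚ y = mkℤp (λ m → seq x m + seq y m)
    (λ m → subst (λ t → (+ (p ℕ.^ m)) ∣ t)
      (lem (seq x (suc m)) (seq x m) (seq y (suc m)) (seq y m))
      (∣m∣n⇒∣m+n (coh x m) (coh y m)))
    where
    lem : ∀ a b c d → (a - b) + (c - d) ≡ (a + c) - (b + d)
    lem = solve 4 (λ a b c d → (a :- b) :+ (c :- d) := (a :+ c) :- (b :+ d)) Relation.Binary.PropositionalEquality.refl
      where import Relation.Binary.PropositionalEquality

  _*ₚ_ : ℤp p → ℤp p → ℤp p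
  x *ₚ y = mkℤp (λ m → seq x m * seq y m)
    (λ m → subst (λ t → (+ (p ℕ.^ m)) ∣ t)
      (lem (seq x (suc m)) (seq x m) (seq y (suc m)) (seq y m))
      (∣m∣n⇒∣m+n (∣n⇒∣m*n (seq x (suc m)) (coh y m)) (∣m⇒∣m*n (seq y m) (coh x m))))
    where
    lem : ∀ a b c d → a * (c - d) + (a - b) * d ≡ a * c - b * d
    lem = solve 4 (λ a b c d → a :* (c :- d) :+ (a :- b) :* d := a :* c :- b :* d) Relation.Binary.PropositionalEquality.refl
      where import Relation.Binary.PropositionalEquality

  _^ₚ_ : ℤp p → ℕ → ℤp p
  x ^ₚ zero = ι (+ 1)
  x ^ₚ suc e = x *ₚ (x ^ₚ e)

  _∣ₚ_ : ℤp p → ℤp p → Set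
  a ∣ₚ b = Σ (ℤp p) λ c → b ≈ a *ₚ c

  pₚ : ℤp p
  pₚ = ι (+ p)

  Primitive : ℤp p → ℤp p → ℤp p → Set
  Primitive x y z = ¬ (pₚ ∣ₚ x × pₚ ∣ₚ y × pₚ ∣ₚ z)

module Submission where

-- Read the equation at level n + 1, i.e. as a congruence of integers modulo p^(n+1).
-- As k ≥ 2 it forces p ∣ x, then p ∣ z because p ∤ C'; so p^(n+1) divides p C' z^n and
-- hence p^k ∣ x², i.e. v(x) ≥ ⌈k/2⌉. For even k, substituting x = p^(k/2) X and z = p Z
-- turns the equation into p^k times (i), and p^k cancels in ℤ_p. For odd k, v(x) ≥ (k+1)/2
-- gives p^(k+1) ∣ p^k B' y², so p ∣ y, contradicting primitivity; conversely (ii) implies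
-- the equation by the same rescaling.


open import Defs
open import Data.Nat using (ℕ; _≥_; _<_; _%_; _/_; _∸_)
open import Data.Nat as ℕ using ()
open import Data.Integer using (ℤ; +_)
open import Data.Integer as ℤ using ()
open import Data.Integer.Divisibility.Signed using (_∣_)
open import Data.Nat.Primality using (Prime)
open import Data.Product using (Σ; _×_)
open import Data.Sum using (_⊎_)
open import Function.Bundles using (_⇔_)
open import Relation.Binary.PropositionalEquality using (_≡_)
open import Relation.Nullary using (¬_)
open import Data.Nat using (zero; suc; _^_; _≤_)
open import Data.Nat.DivMod using (m/n≡1+[m∸n]/n)
open import Data.Nat.Primality using (prime⇒nonZero; euclidsLemma)
import Data.Nat.Divisibility as ℕ
import Data.Nat.Properties as ℕ
open import Data.Integer using (_+_; _-_; _*_; -_)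
import Data.Integer.Properties as ℤ
open import Data.Integer.Divisibility.Signed
  using ( divides; quotient; ∣-refl; ∣-trans; ∣m∣n⇒∣m+n; ∣m⇒∣-m; ∣m+n∣n⇒∣m; ∣m+n∣m⇒∣n
        ; ∣n⇒∣m*n; ∣m⇒∣m*n; *-monoˡ-∣; *-monoʳ-∣; *-cancelˡ-∣; *-cancelʳ-∣; ∣ᵤ⇒∣; ∣⇒∣ᵤ)
open import Data.Integer.Tactic.RingSolver using (solve-∀)
open import Algebra.Properties.Ring ℤ.+-*-ring using (x[y-z]≈xy-xz; [y-z]x≈yx-zx)
open import Data.Product using (_,_; proj₁; proj₂)
open import Data.Sum using (inj₁; inj₂; [_,_]′)
open import Data.Empty using (⊥-elim)
open import Function using (id; flip; _∘_)
open import Function.Bundles using (mk⇔; Equivalence)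
open import Level using (0ℓ)
open import Relation.Binary.Bundles using (Setoid)
import Relation.Binary.Reasoning.Setoid as ≈-Reasoning
open import Relation.Binary.PropositionalEquality
  using (refl; sym; trans; cong; cong₂; subst; subst₂; module ≡-Reasoning)
open import Relation.Nullary using (contradiction)

infix 4 _≡_[mod_]
_≡_[mod_] : ℤ → ℤ → ℤ → Set
a ≡ b [mod q ] = q ∣ a - b

module _ {q : ℤ} where

  mod-refl : ∀ {a} → a ≡ a [mod q ]
  mod-refl {a} = subst (q ∣_) (sym (ℤ.+-inverseʳ a)) (divides (+ 0) refl)

  mod-sym : ∀ {a b} → a ≡ b [mod q ] → b ≡ a [mod q ]
  mod-sym {a} {b} a≡b = subst (q ∣_) (identity a b) (∣m⇒∣-m a≡b)
    where
    identity : ∀ a b → - (a - b) ≡ b - a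
    identity = solve-∀

  mod-trans : ∀ {a b c} → a ≡ b [mod q ] → b ≡ c [mod q ] → a ≡ c [mod q ]
  mod-trans {a} {b} {c} a≡b b≡c = subst (q ∣_) (identity a b c) (∣m∣n⇒∣m+n a≡b b≡c)
    where
    identity : ∀ a b c → (a - b) + (b - c) ≡ a - c
    identity = solve-∀

  mod-+-cong : ∀ {a b c d} → a ≡ b [mod q ] → c ≡ d [mod q ] → a + c ≡ b + d [mod q ]
  mod-+-cong {a} {b} {c} {d} a≡b c≡d = subst (q ∣_) (identity a b c d) (∣m∣n⇒∣m+n a≡b c≡d)
    where
    identity : ∀ a b c d → (a - b) + (c - d) ≡ (a + c) - (b + d)
    identity = solve-∀

  mod-*-cong : ∀ {a b c d} → a ≡ b [mod q ] → c ≡ d [mod q ] → a * c ≡ b * d [mod q ]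
  mod-*-cong {a} {b} {c} {d} a≡b c≡d =
    subst (q ∣_) (identity a b c d) (∣m∣n⇒∣m+n (∣n⇒∣m*n a c≡d) (∣m⇒∣m*n d a≡b))
    where
    identity : ∀ a b c d → a * (c - d) + (a - b) * d ≡ a * c - b * d
    identity = solve-∀

  mod-∣ʳ : ∀ {a b} → a ≡ b [mod q ] → q ∣ b → q ∣ a
  mod-∣ʳ {a} {b} a≡b q∣b = subst (q ∣_) (identity a b) (∣m∣n⇒∣m+n a≡b q∣b)
    where
    identity : ∀ a b → (a - b) + b ≡ a
    identity = solve-∀

  mod-∣ˡ : ∀ {a b} → a ≡ b [mod q ] → q ∣ a → q ∣ b
  mod-∣ˡ {a} {b} a≡b = mod-∣ʳ (mod-sym {a} {b} a≡b)

pow-one : ∀ p → + (p ^ 1) ≡ + p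
pow-one p = cong +_ (ℕ.*-identityʳ p)

pow-suc : ∀ p e → + (p ^ suc e) ≡ + p * + (p ^ e)
pow-suc p e = ℤ.pos-* p (p ^ e)

pow-+ : ∀ p i j → + (p ^ (i ℕ.+ j)) ≡ + (p ^ i) * + (p ^ j)
pow-+ p i j = trans (cong +_ (ℕ.^-distribˡ-+-* p i j)) (ℤ.pos-* (p ^ i) (p ^ j))

pow-∣-pow : ∀ p {i j} → i ≤ j → + (p ^ i) ∣ + (p ^ j)
pow-∣-pow p {i} {j} i≤j = subst (λ e → + (p ^ i) ∣ + (p ^ e)) (ℕ.m+[n∸m]≡n i≤j)
  (subst (+ (p ^ i) ∣_) (sym (pow-+ p i (j ℕ.∸ i))) (∣m⇒∣m*n _ ∣-refl))

∣⇒pow-∣-^ : ∀ {p c} n → + p ∣ c → + (p ^ n) ∣ c ℤ.^ n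
∣⇒pow-∣-^ zero p∣c = ∣-refl
∣⇒pow-∣-^ {p} {c} (suc n) p∣c = subst (_∣ c ℤ.^ suc n) (sym (pow-suc p n))
  (∣-trans (*-monoˡ-∣ _ p∣c) (*-monoʳ-∣ c (∣⇒pow-∣-^ n p∣c)))

square-* : ∀ a b → (a * b) ℤ.^ 2 ≡ a ℤ.^ 2 * (b * b)
square-* = identity
  where
  identity : ∀ a b → (a * b) * ((a * b) * + 1) ≡ (a * (a * + 1)) * (b * b)
  identity = solve-∀

rescale-even : ∀ {q r} X y b → q * q ≡ r →
  (q * X) ℤ.^ 2 + (r * b) * y ℤ.^ 2 ≡ r * (X ℤ.^ 2 + b * y ℤ.^ 2)
rescale-even {q} X y b refl = identity q X y b
  where
  identity : ∀ q X y b → (q * X) * ((q * X) * + 1) + ((q * q) * b) * (y * (y * + 1))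
                        ≡ (q * q) * (X * (X * + 1) + b * (y * (y * + 1)))
  identity = solve-∀

rescale-odd : ∀ {q r} s X y b → q * q ≡ r * s →
  (q * X) ℤ.^ 2 + (r * b) * y ℤ.^ 2 ≡ r * (s * X ℤ.^ 2 + b * y ℤ.^ 2)
rescale-odd {q} {r} s X y b q²≡rs = begin
  (q * X) ℤ.^ 2 + (r * b) * y ℤ.^ 2      ≡⟨ cong (_+ (r * b) * y ℤ.^ 2) [qX]²≡X²q² ⟩
  X ℤ.^ 2 * (q * q) + (r * b) * y ℤ.^ 2  ≡⟨ cong (λ t → X ℤ.^ 2 * t + (r * b) * y ℤ.^ 2) q²≡rs ⟩
  X ℤ.^ 2 * (r * s) + (r * b) * y ℤ.^ 2  ≡⟨ identity r s X y b ⟩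
  r * (s * X ℤ.^ 2 + b * y ℤ.^ 2)        ∎
  where
  open ≡-Reasoning
  [qX]²≡X²q² : (q * X) ℤ.^ 2 ≡ X ℤ.^ 2 * (q * q)
  [qX]²≡X²q² = trans (cong (ℤ._^ 2) (ℤ.*-comm q X)) (square-* X q)
  identity : ∀ r s X y b → X * (X * + 1) * (r * s) + (r * b) * (y * (y * + 1))
                          ≡ r * (s * (X * (X * + 1)) + b * (y * (y * + 1)))
  identity = solve-∀

rescale-rhs : ∀ {s t r u} c w → s * t ≡ r * u → (s * c) * (t * w) ≡ r * ((u * c) * w)
rescale-rhs {s} {t} {r} {u} c w st≡ru = begin
  (s * c) * (t * w)  ≡⟨ identity₁ s c t w ⟩
  (s * t) * (c * w)  ≡⟨ cong (_* (c * w)) st≡ru ⟩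
  (r * u) * (c * w)  ≡⟨ identity₂ r u c w ⟩
  r * ((u * c) * w)  ∎
  where
  open ≡-Reasoning
  identity₁ : ∀ s c t w → (s * c) * (t * w) ≡ (s * t) * (c * w)
  identity₁ = solve-∀
  identity₂ : ∀ r u c w → (r * u) * (c * w) ≡ r * ((u * c) * w)
  identity₂ = solve-∀

module _ {p : ℕ} (p-prime : Prime p) where

  private instance
    p≢0 : ℕ.NonZero p
    p≢0 = prime⇒nonZero p-prime

  p∣ab⇒p∣a⊎p∣b : ∀ a b → + p ∣ a * b → + p ∣ a ⊎ + p ∣ b
  p∣ab⇒p∣a⊎p∣b a b p∣ab
    with euclidsLemma ℤ.∣ a ∣ ℤ.∣ b ∣ p-prime (subst (p ℕ.∣_) (ℤ.abs-* a b) (∣⇒∣ᵤ p∣ab))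
  ... | inj₁ p∣a = inj₁ (∣ᵤ⇒∣ p∣a)
  ... | inj₂ p∣b = inj₂ (∣ᵤ⇒∣ p∣b)

  p∣aⁿ⇒p∣a : ∀ {a} n .{{_ : ℕ.NonZero n}} → + p ∣ a ℤ.^ n → + p ∣ a
  p∣aⁿ⇒p∣a {a} 1 p∣a¹ = subst (+ p ∣_) (ℤ.*-identityʳ a) p∣a¹
  p∣aⁿ⇒p∣a {a} (suc n@(suc _)) p∣aⁿ = [ id , p∣aⁿ⇒p∣a n ]′ (p∣ab⇒p∣a⊎p∣b a (a ℤ.^ n) p∣aⁿ)

  p∣qa⇒p∣a : ∀ {q a} → ¬ + p ∣ q → + p ∣ q * a → + p ∣ a
  p∣qa⇒p∣a {q} {a} p∤q p∣qa = [ flip contradiction p∤q , id ]′ (p∣ab⇒p∣a⊎p∣b q a p∣qa)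

  p²ⁱ⁺¹∣a²⇒pⁱ⁺¹∣a : ∀ i {a} → + (p ^ suc (i ℕ.+ i)) ∣ a ℤ.^ 2 → + (p ^ suc i) ∣ a
  p²ⁱ⁺¹∣a²⇒pⁱ⁺¹∣a zero {a} h = subst (_∣ a) (sym (pow-one p))
    (p∣aⁿ⇒p∣a 2 (subst (_∣ a ℤ.^ 2) (pow-one p) h))
  p²ⁱ⁺¹∣a²⇒pⁱ⁺¹∣a (suc i) {a} h with p²ⁱ⁺¹∣a²⇒pⁱ⁺¹∣a i {a} (∣-trans (pow-∣-pow p 2i+1≤2i+3) h)
    where
    2i+1≤2i+3 : suc (i ℕ.+ i) ≤ suc (suc i ℕ.+ suc i)
    2i+1≤2i+3 = ℕ.s≤s (ℕ.+-mono-≤ (ℕ.n≤1+n i) (ℕ.n≤1+n i))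
  ... | divides a′ refl = subst (_∣ a′ * P) (sym (pow-suc p (suc i)))
    (*-monoˡ-∣ P (p∣aⁿ⇒p∣a {a′} 2 (*-cancelʳ-∣ P² p·P²∣a′²·P²)))
    where
    P P² : ℤ
    P = + (p ^ suc i)
    P² = + (p ^ (suc i ℕ.+ suc i))
    instance
      P²≢0 : ℕ.NonZero (p ^ (suc i ℕ.+ suc i))
      P²≢0 = ℕ.m^n≢0 p (suc i ℕ.+ suc i)
    [a′P]²≡a′²P² : (a′ * P) ℤ.^ 2 ≡ a′ ℤ.^ 2 * P²
    [a′P]²≡a′²P² = trans (square-* a′ P) (cong (a′ ℤ.^ 2 *_) (sym (pow-+ p (suc i) (suc i))))
    p·P²∣a′²·P² : + p * P² ∣ a′ ℤ.^ 2 * P²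
    p·P²∣a′²·P² = subst₂ _∣_ (pow-suc p (suc i ℕ.+ suc i)) [a′P]²≡a′²P² h

  p²ⁱ∣a²⇒pⁱ∣a : ∀ i {a} → + (p ^ (i ℕ.+ i)) ∣ a ℤ.^ 2 → + (p ^ i) ∣ a
  p²ⁱ∣a²⇒pⁱ∣a zero {a} _ = divides a (sym (ℤ.*-identityʳ a))
  p²ⁱ∣a²⇒pⁱ∣a (suc i) {a} h = p²ⁱ⁺¹∣a²⇒pⁱ⁺¹∣a i (∣-trans (pow-∣-pow p 2i+1≤2i+2) h)
    where
    2i+1≤2i+2 : suc (i ℕ.+ i) ≤ suc i ℕ.+ suc i
    2i+1≤2i+2 = ℕ.s≤s (ℕ.+-monoʳ-≤ i (ℕ.n≤1+n i))

pⁱ∣a⇒p²ⁱ∣a² : ∀ p i {a} → + (p ^ i) ∣ a → + (p ^ (i ℕ.+ i)) ∣ a ℤ.^ 2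
pⁱ∣a⇒p²ⁱ∣a² p i (divides a′ refl) =
  divides (a′ ℤ.^ 2) (trans (square-* a′ _) (cong (a′ ℤ.^ 2 *_) (sym (pow-+ p i i))))

module Valuation {p : ℕ} (p-prime : Prime p) {n k : ℕ} {B C a b c : ℤ}
  (p∤BC : ¬ + p ∣ B * C) (2≤k : 2 ≤ k) (k≤n : k ≤ n)
  (equation : a ℤ.^ 2 + (+ (p ^ k) * B) * b ℤ.^ 2 ≡ (+ p * C) * c ℤ.^ n [mod + (p ^ suc n) ])
  where

  private instance
    p≢0 : ℕ.NonZero p
    p≢0 = prime⇒nonZero p-prime
    n≢0 : ℕ.NonZero n
    n≢0 = ℕ.>-nonZero (ℕ.≤-trans (ℕ.s≤s ℕ.z≤n) (ℕ.≤-trans 2≤k k≤n))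

  p∤B : ¬ + p ∣ B
  p∤B = p∤BC ∘ ∣m⇒∣m*n C

  p∤C : ¬ + p ∣ C
  p∤C = p∤BC ∘ ∣n⇒∣m*n B

  equation-mod : ∀ {i} → i ≤ suc n →
    a ℤ.^ 2 + (+ (p ^ k) * B) * b ℤ.^ 2 ≡ (+ p * C) * c ℤ.^ n [mod + (p ^ i) ]
  equation-mod i≤n+1 = ∣-trans (pow-∣-pow p i≤n+1) equation

  pⁱ∣pᵏBb² : ∀ {i} → i ≤ k → + (p ^ i) ∣ (+ (p ^ k) * B) * b ℤ.^ 2
  pⁱ∣pᵏBb² i≤k = ∣m⇒∣m*n _ (∣m⇒∣m*n B (pow-∣-pow p i≤k))

  p∣a : + p ∣ a
  p∣a = subst (_∣ a) (pow-one p) (p²ⁱ⁺¹∣a²⇒pⁱ⁺¹∣a p-prime 0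
    (∣m+n∣n⇒∣m (mod-∣ʳ (equation-mod (ℕ.s≤s ℕ.z≤n)) p∣pCcⁿ) (pⁱ∣pᵏBb² (ℕ.≤-trans (ℕ.n≤1+n 1) 2≤k))))
    where
    p∣pCcⁿ : + (p ^ 1) ∣ (+ p * C) * c ℤ.^ n
    p∣pCcⁿ = subst (_∣ (+ p * C) * c ℤ.^ n) (sym (pow-one p)) (∣m⇒∣m*n _ (∣m⇒∣m*n C ∣-refl))

  p∣c : + p ∣ c
  p∣c = p∣aⁿ⇒p∣a p-prime n (p∣qa⇒p∣a p-prime p∤C (*-cancelˡ-∣ (+ p) p·p∣p·Ccⁿ))
    where
    p²∣a² : + (p ^ 2) ∣ a ℤ.^ 2
    p²∣a² = pⁱ∣a⇒p²ⁱ∣a² p 1 (subst (_∣ a) (sym (pow-one p)) p∣a)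
    p²∣pCcⁿ : + (p ^ 2) ∣ (+ p * C) * c ℤ.^ n
    p²∣pCcⁿ = mod-∣ˡ (equation-mod (ℕ.≤-trans 2≤k (ℕ.≤-trans k≤n (ℕ.n≤1+n n))))
      (∣m∣n⇒∣m+n p²∣a² (pⁱ∣pᵏBb² 2≤k))
    p·p∣p·Ccⁿ : + p * + p ∣ + p * (C * c ℤ.^ n)
    p·p∣p·Ccⁿ = subst₂ _∣_ (trans (pow-suc p 1) (cong (+ p *_) (pow-one p)))
      (ℤ.*-assoc (+ p) C (c ℤ.^ n)) p²∣pCcⁿ

  pⁿ⁺¹∣a²+pᵏBb² : + (p ^ suc n) ∣ a ℤ.^ 2 + (+ (p ^ k) * B) * b ℤ.^ 2
  pⁿ⁺¹∣a²+pᵏBb² = mod-∣ʳ equation (subst₂ _∣_ (sym (pow-suc p n)) (sym (ℤ.*-assoc (+ p) C (c ℤ.^ n)))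
    (*-monoʳ-∣ (+ p) (∣n⇒∣m*n C (∣⇒pow-∣-^ n p∣c))))

  pᵏ∣a² : + (p ^ k) ∣ a ℤ.^ 2
  pᵏ∣a² = ∣m+n∣n⇒∣m (∣-trans (pow-∣-pow p (ℕ.≤-trans k≤n (ℕ.n≤1+n n))) pⁿ⁺¹∣a²+pᵏBb²) (pⁱ∣pᵏBb² ℕ.≤-refl)

  p∣b-odd : ∀ {j} → k ℕ.+ 1 ≡ j ℕ.+ j → + p ∣ b
  p∣b-odd {zero} k+1≡0 = contradiction (trans (ℕ.+-comm 1 k) k+1≡0) ℕ.1+n≢0
  p∣b-odd {suc i} k+1≡j+j =
    p∣aⁿ⇒p∣a p-prime 2 (p∣qa⇒p∣a p-prime p∤B (*-cancelˡ-∣ (+ (p ^ k)) pᵏ·p∣pᵏ·Bb²))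
    where
    instance
      pᵏ≢0 : ℕ.NonZero (p ^ k)
      pᵏ≢0 = ℕ.m^n≢0 p k
    1+k≡j+j : suc k ≡ suc i ℕ.+ suc i
    1+k≡j+j = trans (ℕ.+-comm 1 k) k+1≡j+j
    pʲ∣a : + (p ^ suc i) ∣ a
    pʲ∣a = p²ⁱ⁺¹∣a²⇒pⁱ⁺¹∣a p-prime i
      (subst (λ e → + (p ^ e) ∣ a ℤ.^ 2) (trans (ℕ.suc-injective 1+k≡j+j) (ℕ.+-suc i i)) pᵏ∣a²)
    pᵏ⁺¹∣a² : + (p ^ suc k) ∣ a ℤ.^ 2
    pᵏ⁺¹∣a² = subst (λ e → + (p ^ e) ∣ a ℤ.^ 2) (sym 1+k≡j+j) (pⁱ∣a⇒p²ⁱ∣a² p (suc i) pʲ∣a)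
    pᵏ·p∣pᵏ·Bb² : + (p ^ k) * + p ∣ + (p ^ k) * (B * b ℤ.^ 2)
    pᵏ·p∣pᵏ·Bb² = subst₂ _∣_ (trans (pow-suc p k) (ℤ.*-comm (+ p) (+ (p ^ k))))
      (ℤ.*-assoc (+ (p ^ k)) B (b ℤ.^ 2))
      (∣m+n∣m⇒∣n (∣-trans (pow-∣-pow p (ℕ.s≤s k≤n)) pⁿ⁺¹∣a²+pᵏBb²) pᵏ⁺¹∣a²)

module _ {p : ℕ} where

  ≈-refl : {x : ℤp p} → x ≈ x
  ≈-refl {x} m = mod-refl {a = seq x m}

  ≈-sym : {x y : ℤp p} → x ≈ y → y ≈ x
  ≈-sym {x} {y} x≈y m = mod-sym {a = seq x m} {seq y m} (x≈y m)

  ≈-trans : {x y z : ℤp p} → x ≈ y → y ≈ z → x ≈ z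
  ≈-trans {x} {y} {z} x≈y y≈z m = mod-trans {a = seq x m} {seq y m} {seq z m} (x≈y m) (y≈z m)

  ≈-setoid : Setoid 0ℓ 0ℓ
  ≈-setoid = record
    { Carrier = ℤp p
    ; _≈_ = _≈_
    ; isEquivalence = record
      { refl = λ {x} → ≈-refl {x}
      ; sym = λ {x} {y} → ≈-sym {x} {y}
      ; trans = λ {x} {y} {z} → ≈-trans {x} {y} {z}
      }
    }

  +ₚ-cong : {x y u v : ℤp p} → x ≈ y → u ≈ v → x +ₚ u ≈ y +ₚ v
  +ₚ-cong {x} {y} {u} {v} x≈y u≈v m =
    mod-+-cong {a = seq x m} {seq y m} {seq u m} {seq v m} (x≈y m) (u≈v m)

  *ₚ-cong : {x y u v : ℤp p} → x ≈ y → u ≈ v → x *ₚ u ≈ y *ₚ v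
  *ₚ-cong {x} {y} {u} {v} x≈y u≈v m =
    mod-*-cong {a = seq x m} {seq y m} {seq u m} {seq v m} (x≈y m) (u≈v m)

  ^ₚ-congˡ : {x y : ℤp p} → x ≈ y → ∀ e → x ^ₚ e ≈ y ^ₚ e
  ^ₚ-congˡ x≈y zero = ≈-refl {ι (+ 1)}
  ^ₚ-congˡ {x} {y} x≈y (suc e) = *ₚ-cong {x} {y} {x ^ₚ e} {y ^ₚ e} x≈y (^ₚ-congˡ x≈y e)

  seq-≡⇒≈ : {x y : ℤp p} → (∀ m → seq x m ≡ seq y m) → x ≈ y
  seq-≡⇒≈ {x} x≡y m = subst (λ t → seq x m ≡ t [mod + (p ^ m) ]) (x≡y m) (mod-refl {a = seq x m})

  seq-^ₚ : (x : ℤp p) (e m : ℕ) → seq (x ^ₚ e) m ≡ seq x m ℤ.^ e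
  seq-^ₚ x zero m = refl
  seq-^ₚ x (suc e) m = cong (seq x m *_) (seq-^ₚ x e m)

  seq-^ₚ-*ₚ : (x y : ℤp p) (e m : ℕ) → seq ((x *ₚ y) ^ₚ e) m ≡ seq (x ^ₚ e) m * seq (y ^ₚ e) m
  seq-^ₚ-*ₚ x y zero m = refl
  seq-^ₚ-*ₚ x y (suc e) m = trans (cong (seq x m * seq y m *_) (seq-^ₚ-*ₚ x y e m))
    (identity (seq x m) (seq y m) (seq (x ^ₚ e) m) (seq (y ^ₚ e) m))
    where
    identity : ∀ a b c d → (a * b) * (c * d) ≡ (a * c) * (b * d)
    identity = solve-∀

  seq-pₚ^ : (j m : ℕ) → seq (pₚ {p} ^ₚ j) m ≡ + (p ^ j)
  seq-pₚ^ zero m = refl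
  seq-pₚ^ (suc j) m = trans (cong (+ p *_) (seq-pₚ^ j m)) (sym (pow-suc p j))

  seq-pₚ^-+ : (i j m : ℕ) → seq (pₚ {p} ^ₚ (i ℕ.+ j)) m ≡ seq (pₚ ^ₚ i) m * seq (pₚ ^ₚ j) m
  seq-pₚ^-+ i j m = trans (seq-pₚ^ (i ℕ.+ j) m)
    (trans (pow-+ p i j) (sym (cong₂ _*_ (seq-pₚ^ i m) (seq-pₚ^ j m))))

  seq-≡[mod] : (x : ℤp p) (d m : ℕ) → seq x (d ℕ.+ m) ≡ seq x m [mod + (p ^ m) ]
  seq-≡[mod] x zero m = mod-refl {a = seq x m}
  seq-≡[mod] x (suc d) m = mod-trans {a = seq x (suc d ℕ.+ m)} {seq x (d ℕ.+ m)} {seq x m}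
    (∣-trans (pow-∣-pow p (ℕ.m≤n+m m d)) (coh x (d ℕ.+ m))) (seq-≡[mod] x d m)

  seq-≡[mod]-≤ : (x : ℤp p) {m M : ℕ} → m ≤ M → seq x M ≡ seq x m [mod + (p ^ m) ]
  seq-≡[mod]-≤ x {m} {M} m≤M =
    subst (λ t → seq x t ≡ seq x m [mod + (p ^ m) ]) (ℕ.m∸n+n≡m m≤M) (seq-≡[mod] x (M ℕ.∸ m) m)

  module _ .{{_ : ℕ.NonZero p}} where

    pow-∣-seq⇒∣ₚ : (x : ℤp p) {j M : ℕ} → j ≤ M → + (p ^ j) ∣ seq x M → pₚ ^ₚ j ∣ₚ x
    pow-∣-seq⇒∣ₚ x {j} {M} j≤M pʲ∣x = X , x≈pʲX
      where
      P : ℤ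
      P = + (p ^ j)
      instance
        pʲ≢0 : ℕ.NonZero (p ^ j)
        pʲ≢0 = ℕ.m^n≢0 p j
      pʲ∣x-shifted : ∀ m → P ∣ seq x (m ℕ.+ j)
      pʲ∣x-shifted m = mod-∣ʳ {a = seq x (m ℕ.+ j)} {seq x M}
        (mod-trans {a = seq x (m ℕ.+ j)} {seq x j} {seq x M} (seq-≡[mod] x m j)
          (mod-sym {a = seq x M} {seq x j} (seq-≡[mod]-≤ x j≤M)))
        pʲ∣x
      X-seq : ℕ → ℤ
      X-seq m = quotient (pʲ∣x-shifted m)
      X-coh : ∀ m → + (p ^ m) ∣ X-seq (suc m) - X-seq m
      X-coh m = *-cancelʳ-∣ P (subst₂ _∣_ (pow-+ p m j)
        (trans (cong₂ _-_ (_∣_.equality (pʲ∣x-shifted (suc m))) (_∣_.equality (pʲ∣x-shifted m)))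
               (sym ([y-z]x≈yx-zx P (X-seq (suc m)) (X-seq m))))
        (coh x (m ℕ.+ j)))
      X : ℤp p
      X = mkℤp X-seq X-coh
      x≈pʲX : x ≈ pₚ ^ₚ j *ₚ X
      x≈pʲX m = subst (λ t → seq x m ≡ t [mod + (p ^ m) ])
        (sym (trans (cong (_* X-seq m) (seq-pₚ^ j m))
                    (trans (ℤ.*-comm P (X-seq m)) (sym (_∣_.equality (pʲ∣x-shifted m))))))
        (mod-sym {a = seq x (m ℕ.+ j)} {seq x m} (seq-≡[mod]-≤ x (ℕ.m≤m+n m j)))

    p∣seq⇒pₚ∣ₚ : (x : ℤp p) {M : ℕ} → 1 ≤ M → + p ∣ seq x M → pₚ ∣ₚ x
    p∣seq⇒pₚ∣ₚ x {M} 1≤M p∣x =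
      p¹∣ₚx⇒pₚ∣ₚx (pow-∣-seq⇒∣ₚ x 1≤M (subst (_∣ seq x M) (sym (pow-one p)) p∣x))
      where
      p¹∣ₚx⇒pₚ∣ₚx : pₚ ^ₚ 1 ∣ₚ x → pₚ ∣ₚ x
      p¹∣ₚx⇒pₚ∣ₚx (X , x≈p¹X) = X , ≈-trans {x} {pₚ ^ₚ 1 *ₚ X} {pₚ *ₚ X} x≈p¹X
        (seq-≡⇒≈ {pₚ ^ₚ 1 *ₚ X} {pₚ *ₚ X} λ m → cong (_* seq X m) (ℤ.*-identityʳ (+ p)))

    pₚ^-*ₚ-cancelˡ : ∀ j {u v : ℤp p} → pₚ ^ₚ j *ₚ u ≈ pₚ ^ₚ j *ₚ v → u ≈ v
    pₚ^-*ₚ-cancelˡ j {u} {v} pʲu≈pʲv m =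
      mod-trans {a = seq u m} {seq u (j ℕ.+ m)} {seq v m}
        (mod-sym {a = seq u (j ℕ.+ m)} {seq u m} (seq-≡[mod] u j m))
        (mod-trans {a = seq u (j ℕ.+ m)} {seq v (j ℕ.+ m)} {seq v m} shifted (seq-≡[mod] v j m))
      where
      instance
        pʲ≢0 : ℕ.NonZero (p ^ j)
        pʲ≢0 = ℕ.m^n≢0 p j
      shifted : seq u (j ℕ.+ m) ≡ seq v (j ℕ.+ m) [mod + (p ^ m) ]
      shifted = *-cancelˡ-∣ (+ (p ^ j)) (subst₂ _∣_ (pow-+ p j m)
        (trans (cong (λ t → t * seq u (j ℕ.+ m) - t * seq v (j ℕ.+ m)) (seq-pₚ^ j (j ℕ.+ m)))
               (sym (x[y-z]≈xy-xz (+ (p ^ j)) (seq u (j ℕ.+ m)) (seq v (j ℕ.+ m)))))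
        (pʲu≈pʲv (j ℕ.+ m)))

    pₚ^-*ₚ-cancel-⇔ : ∀ j (a a′ b b′ : ℤp p) →
      a ≈ pₚ ^ₚ j *ₚ a′ → b ≈ pₚ ^ₚ j *ₚ b′ → (a ≈ b ⇔ a′ ≈ b′)
    pₚ^-*ₚ-cancel-⇔ j a a′ b b′ a≈pʲa′ b≈pʲb′ = mk⇔
      (λ a≈b → pₚ^-*ₚ-cancelˡ j {a′} {b′} (begin
        pₚ ^ₚ j *ₚ a′  ≈⟨ a≈pʲa′ ⟨
        a              ≈⟨ a≈b ⟩
        b              ≈⟨ b≈pʲb′ ⟩
        pₚ ^ₚ j *ₚ b′  ∎))
      (λ a′≈b′ → begin
        a              ≈⟨ a≈pʲa′ ⟩
        pₚ ^ₚ j *ₚ a′  ≈⟨ *ₚ-cong {pₚ ^ₚ j} {pₚ ^ₚ j} {a′} {b′} (≈-refl {pₚ ^ₚ j}) a′≈b′ ⟩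
        pₚ ^ₚ j *ₚ b′  ≈⟨ b≈pʲb′ ⟨
        b              ∎)
      where open ≈-Reasoning ≈-setoid

module Reduction {p : ℕ} (p-prime : Prime p) (n k : ℕ) (B C : ℤ) (p∤BC : ¬ + p ∣ B * C)
  (1<k : 1 < k) (k<n+1 : k < n ℕ.+ 1) (x y z : ℤp p) where

  private instance
    p≢0 : ℕ.NonZero p
    p≢0 = prime⇒nonZero p-prime

  k≤n : k ≤ n
  k≤n = ℕ.m<1+n⇒m≤n (subst (k <_) (ℕ.+-comm n 1) k<n+1)

  lhs rhs : ℤp p → ℤp p
  lhs u = u ^ₚ 2 +ₚ ι (+ (p ^ k) * B) *ₚ y ^ₚ 2
  rhs w = ι (+ p * C) *ₚ w ^ₚ n

  reduced-lhs-even reduced-lhs-odd reduced-rhs : ℤp p → ℤp p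
  reduced-lhs-even X = X ^ₚ 2 +ₚ ι B *ₚ y ^ₚ 2
  reduced-lhs-odd X = pₚ *ₚ X ^ₚ 2 +ₚ ι B *ₚ y ^ₚ 2
  reduced-rhs Z = pₚ ^ₚ (n ℕ.+ 1 ℕ.∸ k) *ₚ ι C *ₚ Z ^ₚ n

  lhs-cong : ∀ {u v} → u ≈ v → lhs u ≈ lhs v
  lhs-cong {u} {v} u≈v =
    +ₚ-cong {x = u ^ₚ 2} {v ^ₚ 2} {By²} {By²} (^ₚ-congˡ {x = u} {v} u≈v 2) (≈-refl {x = By²})
    where
    By² : ℤp p
    By² = ι (+ (p ^ k) * B) *ₚ y ^ₚ 2

  rhs-cong : ∀ {u v} → u ≈ v → rhs u ≈ rhs v
  rhs-cong {u} {v} u≈v = *ₚ-cong {x = ι (+ p * C)} {ι (+ p * C)} {u ^ₚ n} {v ^ₚ n}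
    (≈-refl {x = ι (+ p * C)}) (^ₚ-congˡ {x = u} {v} u≈v n)

  equation-mod-pⁿ⁺¹ : lhs x ≈ rhs z →
    seq x (suc n) ℤ.^ 2 + (+ (p ^ k) * B) * seq y (suc n) ℤ.^ 2
      ≡ (+ p * C) * seq z (suc n) ℤ.^ n [mod + (p ^ suc n) ]
  equation-mod-pⁿ⁺¹ x≈z = subst (λ t → seq (lhs x) (suc n) ≡ (+ p * C) * t [mod + (p ^ suc n) ])
    (seq-^ₚ z n (suc n)) (x≈z (suc n))

  module Valuation-at-level (x≈z : lhs x ≈ rhs z) = Valuation p-prime
    {n} {k} {B} {C} {seq x (suc n)} {seq y (suc n)} {seq z (suc n)} p∤BC 1<k k≤n (equation-mod-pⁿ⁺¹ x≈z)

  lhs-rescale-even : ∀ j X → k ≡ j ℕ.+ j → x ≈ pₚ ^ₚ j *ₚ X → lhs x ≈ pₚ ^ₚ k *ₚ reduced-lhs-even X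
  lhs-rescale-even j X k≡j+j x≈pʲX = begin
    lhs x
      ≈⟨ lhs-cong {x} {pₚ ^ₚ j *ₚ X} x≈pʲX ⟩
    lhs (pₚ ^ₚ j *ₚ X)
      ≈⟨ seq-≡⇒≈ {x = lhs (pₚ ^ₚ j *ₚ X)} {pₚ ^ₚ k *ₚ reduced-lhs-even X} pointwise ⟩
    pₚ ^ₚ k *ₚ reduced-lhs-even X ∎
    where
    open ≈-Reasoning ≈-setoid
    pointwise : ∀ m → seq (lhs (pₚ ^ₚ j *ₚ X)) m ≡ seq (pₚ ^ₚ k *ₚ reduced-lhs-even X) m
    pointwise m =
      trans (rescale-even {q = seq (pₚ ^ₚ j) m} {+ (p ^ k)} (seq X m) (seq y m) B q²≡pᵏ)
      (cong (_* _) (sym (seq-pₚ^ k m)))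
      where
      q²≡pᵏ : seq (pₚ ^ₚ j) m * seq (pₚ ^ₚ j) m ≡ + (p ^ k)
      q²≡pᵏ = trans (sym (seq-pₚ^-+ j j m))
        (trans (cong (λ e → seq (pₚ {p} ^ₚ e) m) (sym k≡j+j)) (seq-pₚ^ k m))

  lhs-rescale-odd : ∀ j X → k ℕ.+ 1 ≡ j ℕ.+ j → x ≈ pₚ ^ₚ j *ₚ X → lhs x ≈ pₚ ^ₚ k *ₚ reduced-lhs-odd X
  lhs-rescale-odd j X k+1≡j+j x≈pʲX = begin
    lhs x
      ≈⟨ lhs-cong {x} {pₚ ^ₚ j *ₚ X} x≈pʲX ⟩
    lhs (pₚ ^ₚ j *ₚ X)
      ≈⟨ seq-≡⇒≈ {x = lhs (pₚ ^ₚ j *ₚ X)} {pₚ ^ₚ k *ₚ reduced-lhs-odd X} pointwise ⟩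
    pₚ ^ₚ k *ₚ reduced-lhs-odd X ∎
    where
    open ≈-Reasoning ≈-setoid
    pointwise : ∀ m → seq (lhs (pₚ ^ₚ j *ₚ X)) m ≡ seq (pₚ ^ₚ k *ₚ reduced-lhs-odd X) m
    pointwise m =
      trans (rescale-odd {q = seq (pₚ ^ₚ j) m} {+ (p ^ k)} (+ p) (seq X m) (seq y m) B q²≡pᵏp)
      (cong (_* _) (sym (seq-pₚ^ k m)))
      where
      q²≡pᵏp : seq (pₚ ^ₚ j) m * seq (pₚ ^ₚ j) m ≡ + (p ^ k) * + p
      q²≡pᵏp = trans (sym (seq-pₚ^-+ j j m))
        (trans (cong (λ e → seq (pₚ {p} ^ₚ e) m) (sym (trans (ℕ.+-comm 1 k) k+1≡j+j)))
          (trans (seq-pₚ^ (suc k) m) (trans (pow-suc p k) (ℤ.*-comm (+ p) (+ (p ^ k))))))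

  rhs-rescale : ∀ Z → z ≈ pₚ *ₚ Z → rhs z ≈ pₚ ^ₚ k *ₚ reduced-rhs Z
  rhs-rescale Z z≈pZ = begin
    rhs z                      ≈⟨ rhs-cong {z} {pₚ *ₚ Z} z≈pZ ⟩
    rhs (pₚ *ₚ Z)              ≈⟨ seq-≡⇒≈ {x = rhs (pₚ *ₚ Z)} {pₚ ^ₚ k *ₚ reduced-rhs Z} pointwise ⟩
    pₚ ^ₚ k *ₚ reduced-rhs Z   ∎
    where
    open ≈-Reasoning ≈-setoid
    n+1≡k+[n+1-k] : suc n ≡ k ℕ.+ (n ℕ.+ 1 ℕ.∸ k)
    n+1≡k+[n+1-k] = trans (ℕ.+-comm 1 n) (sym (ℕ.m+[n∸m]≡n (ℕ.<⇒≤ k<n+1)))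
    pointwise : ∀ m → seq (rhs (pₚ *ₚ Z)) m ≡ seq (pₚ ^ₚ k *ₚ reduced-rhs Z) m
    pointwise m = trans (cong (+ p * C *_) (seq-^ₚ-*ₚ pₚ Z n m))
      (rescale-rhs {s = + p} {seq (pₚ ^ₚ n) m} {seq (pₚ ^ₚ k) m} {seq (pₚ ^ₚ (n ℕ.+ 1 ℕ.∸ k)) m}
        C (seq (Z ^ₚ n) m)
        (trans (cong (λ e → seq (pₚ {p} ^ₚ e) m) n+1≡k+[n+1-k]) (seq-pₚ^-+ k (n ℕ.+ 1 ℕ.∸ k) m)))

  EvenReduced OddReduced : ℕ → Set
  EvenReduced j = Σ (ℤp p) λ X → Σ (ℤp p) λ Z →
    x ≈ pₚ ^ₚ j *ₚ X × z ≈ pₚ *ₚ Z × reduced-lhs-even X ≈ reduced-rhs Z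
  OddReduced j = Σ (ℤp p) λ X → Σ (ℤp p) λ Z →
    x ≈ pₚ ^ₚ j *ₚ X × z ≈ pₚ *ₚ Z × reduced-lhs-odd X ≈ reduced-rhs Z

  even-case : ∀ j → k ≡ j ℕ.+ j → lhs x ≈ rhs z ⇔ EvenReduced j
  even-case j k≡j+j = mk⇔ reduce lift
    where
    rescaled : ∀ X Z → x ≈ pₚ ^ₚ j *ₚ X → z ≈ pₚ *ₚ Z →
      lhs x ≈ rhs z ⇔ reduced-lhs-even X ≈ reduced-rhs Z
    rescaled X Z x≈pʲX z≈pZ = pₚ^-*ₚ-cancel-⇔ k (lhs x) (reduced-lhs-even X) (rhs z) (reduced-rhs Z)
      (lhs-rescale-even j X k≡j+j x≈pʲX) (rhs-rescale Z z≈pZ)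
    j≤n+1 : j ≤ suc n
    j≤n+1 = ℕ.≤-trans (ℕ.m≤m+n j j) (subst (_≤ suc n) k≡j+j (ℕ.≤-trans k≤n (ℕ.n≤1+n n)))
    reduce : lhs x ≈ rhs z → EvenReduced j
    reduce x≈z = combine (pow-∣-seq⇒∣ₚ x j≤n+1 pʲ∣a) (p∣seq⇒pₚ∣ₚ z (ℕ.s≤s ℕ.z≤n) p∣c)
      where
      open Valuation-at-level x≈z
      pʲ∣a : + (p ^ j) ∣ seq x (suc n)
      pʲ∣a = p²ⁱ∣a²⇒pⁱ∣a p-prime j (subst (λ e → + (p ^ e) ∣ seq x (suc n) ℤ.^ 2) k≡j+j pᵏ∣a²)
      combine : pₚ ^ₚ j ∣ₚ x → pₚ ∣ₚ z → EvenReduced j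
      combine (X , x≈pʲX) (Z , z≈pZ) =
        X , Z , x≈pʲX , z≈pZ , Equivalence.to (rescaled X Z x≈pʲX z≈pZ) x≈z
    lift : EvenReduced j → lhs x ≈ rhs z
    lift (X , Z , x≈pʲX , z≈pZ , reduced) = Equivalence.from (rescaled X Z x≈pʲX z≈pZ) reduced

  odd-case : ∀ j → k ℕ.+ 1 ≡ j ℕ.+ j → Primitive x y z → lhs x ≈ rhs z ⇔ OddReduced j
  odd-case j k+1≡j+j prim = mk⇔ (⊥-elim ∘ prim ∘ p-divides-all) lift
    where
    p-divides-all : lhs x ≈ rhs z → pₚ ∣ₚ x × pₚ ∣ₚ y × pₚ ∣ₚ z
    p-divides-all x≈z =
      p∣seq⇒pₚ∣ₚ x 1≤n+1 p∣a , p∣seq⇒pₚ∣ₚ y 1≤n+1 (p∣b-odd {j} k+1≡j+j) , p∣seq⇒pₚ∣ₚ z 1≤n+1 p∣c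
      where
      open Valuation-at-level x≈z
      1≤n+1 : 1 ≤ suc n
      1≤n+1 = ℕ.s≤s ℕ.z≤n
    lift : OddReduced j → lhs x ≈ rhs z
    lift (X , Z , x≈pʲX , z≈pZ , reduced) =
      Equivalence.from (pₚ^-*ₚ-cancel-⇔ k (lhs x) (reduced-lhs-odd X) (rhs z) (reduced-rhs Z)
        (lhs-rescale-odd j X k+1≡j+j x≈pʲX) (rhs-rescale Z z≈pZ)) reduced

double-suc : ∀ {m h} → m ≡ h ℕ.+ h → suc (suc m) ≡ suc h ℕ.+ suc h
double-suc {h = h} refl = cong suc (sym (ℕ.+-suc h h))

half-suc-suc : ∀ m → suc (suc m) / 2 ≡ suc (m / 2)
half-suc-suc m = m/n≡1+[m∸n]/n {suc (suc m)} {2} (ℕ.s≤s (ℕ.s≤s ℕ.z≤n))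

parity : ∀ k → (k % 2 ≡ 0 × k ≡ k / 2 ℕ.+ k / 2)
             ⊎ (k % 2 ≡ 1 × k ℕ.+ 1 ≡ (k ℕ.+ 1) / 2 ℕ.+ (k ℕ.+ 1) / 2)
parity 0 = inj₁ (refl , refl)
parity 1 = inj₂ (refl , refl)
parity (suc (suc k)) with parity k
... | inj₁ (k%2≡0 , k≡h+h) =
  inj₁ (k%2≡0 , trans (double-suc k≡h+h) (cong (λ h → h ℕ.+ h) (sym (half-suc-suc k))))
... | inj₂ (k%2≡1 , k+1≡h+h) =
  inj₂ (k%2≡1 , trans (double-suc k+1≡h+h) (cong (λ h → h ℕ.+ h) (sym (half-suc-suc (k ℕ.+ 1)))))

⇔-inj₁ : {A B C P Q : Set} → P → ¬ Q → A ⇔ B → A ⇔ ((P × B) ⊎ (Q × C))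
⇔-inj₁ p ¬q A⇔B = mk⇔ (λ a → inj₁ (p , Equivalence.to A⇔B a))
  [ Equivalence.from A⇔B ∘ proj₂ , ⊥-elim ∘ ¬q ∘ proj₁ ]′

⇔-inj₂ : {A B C P Q : Set} → ¬ P → Q → A ⇔ C → A ⇔ ((P × B) ⊎ (Q × C))
⇔-inj₂ ¬p q A⇔C = mk⇔ (λ a → inj₂ (q , Equivalence.to A⇔C a))
  [ ⊥-elim ∘ ¬p ∘ proj₁ , Equivalence.from A⇔C ∘ proj₂ ]′

lemma3p5 : (n p k : ℕ) (B' C' : ℤ) →
  n ≥ 3 → n % 2 ≡ 1 → Prime p →
  ¬ (B' ≡ + 0) → ¬ (C' ≡ + 0) → ¬ ((+ p) ∣ (B' ℤ.* C')) →
  1 < k → k < n ℕ.+ 1 →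
  (x y z : ℤp p) → Primitive x y z →
  ((x ^ₚ 2 +ₚ ι (+ (p ℕ.^ k) ℤ.* B') *ₚ y ^ₚ 2 ≈ ι (+ p ℤ.* C') *ₚ z ^ₚ n)
    ⇔
   ((k % 2 ≡ 0 × Σ (ℤp p) λ X → Σ (ℤp p) λ Z →
       x ≈ pₚ ^ₚ (k / 2) *ₚ X × z ≈ pₚ *ₚ Z ×
       X ^ₚ 2 +ₚ ι B' *ₚ y ^ₚ 2 ≈ pₚ ^ₚ (n ℕ.+ 1 ∸ k) *ₚ ι C' *ₚ Z ^ₚ n)
    ⊎
    (k % 2 ≡ 1 × Σ (ℤp p) λ X → Σ (ℤp p) λ Z →
       x ≈ pₚ ^ₚ ((k ℕ.+ 1) / 2) *ₚ X × z ≈ pₚ *ₚ Z ×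
       pₚ *ₚ X ^ₚ 2 +ₚ ι B' *ₚ y ^ₚ 2 ≈ pₚ ^ₚ (n ℕ.+ 1 ∸ k) *ₚ ι C' *ₚ Z ^ₚ n)))
lemma3p5 n p k B′ C′ _ _ p-prime _ _ p∤B′C′ 1<k k<n+1 x y z prim =
  [ (λ (k%2≡0 , k≡j+j) → ⇔-inj₁ k%2≡0 (ℕ.0≢1+n ∘ trans (sym k%2≡0)) (even-case (k / 2) k≡j+j))
  , (λ (k%2≡1 , k+1≡j+j) → ⇔-inj₂ (λ k%2≡0 → ℕ.0≢1+n (trans (sym k%2≡0) k%2≡1)) k%2≡1
                                   (odd-case ((k ℕ.+ 1) / 2) k+1≡j+j prim))
  ]′ (parity k)
  where open Reduction p-prime n k B′ C′ p∤B′C′ 1<k k<n+1 x y z
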